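{- For all integers $k\geq1$ and $n\geq0$, $$ov_k(n)=nov_k(n)-nov_{2k}(n),$$ where, for a positive integer $r$, $ov_r(n)$ (resp. $nov_r(n)$) denotes the sum, over all overpartitions $\lambda$ of $n$, of all overlined (resp. non-overlined) parts of $\lambda$ that are divisible by $r$ (each occurrence counted).
   Context: An overpartition of $n$ is a non-increasing sequence of positive integers summing to $n$ in which the first occurrence of each distinct integer may be overlined. -}

module Defs where

open import Data.Nat using (ℕ; zero; suc; _+_; _*_; _≥_)
open import Data.Nat.Divisibility using (_∣?_)
open import Data.Bool using (Bool; true; false)
open import Data.Product using (_×_; _,_; proj₁)
open import Data.List using (List; []; _∷_; map)
open import Data.Nat.ListAction using (sum)
open import Data.Empty using (⊥)
open import Data.Unit using (⊤)
open import Relation.Binary.PropositionalEquality using (_≡_)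
open import Relation.Nullary using (¬_; yes; no)

-- A part of an overpartition: (size, overlined?)
Part : Set
Part = ℕ × Bool

-- Sequence of parts is non-increasing, and a part may be overlined only if
-- it is the first occurrence of its value, i.e. the preceding part (if any)
-- has a different (hence strictly larger) value.
data WellFormed : List Part → Set where
  wf-[]  : WellFormed []
  wf-one : ∀ {p} → WellFormed (p ∷ [])
  wf-two : ∀ {a x b y rest} →
           a ≥ b →
           (a ≡ b → y ≡ false) →
           WellFormed ((b , y) ∷ rest) →
           WellFormed ((a , x) ∷ (b , y) ∷ rest)

data AllPositive : List Part → Set where
  ap-[] : AllPositive []
  ap-∷  : ∀ {a x rest} → a ≥ 1 → AllPositive rest → AllPositive ((a , x) ∷ rest)

sizeSum : List Part → ℕ
sizeSum ps = sum (map proj₁ ps)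

record IsOverpartition (n : ℕ) (λ′ : List Part) : Set where
  field
    positive   : AllPositive λ′
    wellFormed : WellFormed λ′
    sumsTo     : sizeSum λ′ ≡ n

ovSum : ℕ → List Part → ℕ
ovSum r [] = 0
ovSum r ((a , true) ∷ ps) with r ∣? a
... | yes _ = a + ovSum r ps
... | no  _ = ovSum r ps
ovSum r ((a , false) ∷ ps) = ovSum r ps

novSum : ℕ → List Part → ℕ
novSum r [] = 0
novSum r ((a , false) ∷ ps) with r ∣? a
... | yes _ = a + novSum r ps
... | no  _ = novSum r ps
novSum r ((a , true) ∷ ps) = novSum r ps

-- ov_r(n) and nov_r(n), relative to a list enumerating the overpartitions of n
ovTotal : ℕ → List (List Part) → ℕ
ovTotal r L = sum (map (ovSum r) L)

novTotal : ℕ → List (List Part) → ℕ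
novTotal r L = sum (map (novSum r) L)

-- Let O_n(a) and N_n(a) count the overlined, resp. non-overlined, parts equal to a over all
-- overpartitions of n, and let p(n) be the number of overpartitions of n. Grouping parts by size,
-- ov_k(n) = Σ_{k∣a} a O_n(a), nov_k(n) = Σ_{k∣a} a N_n(a) and nov_{2k}(n) = Σ_{k∣a} 2a N_n(2a),
-- so it suffices that O_n(a) + 2 N_n(2a) = N_n(a) for every a ≥ 1. Deleting one non-overlined a
-- maps the overpartitions of n having one bijectively onto those of n − a, whence
-- N_n(a) = p(n − a) + N_{n−a}(a); deleting the (unique) overlined a maps those having one onto
-- the overpartitions of n − a without an overlined a, whence O_n(a) + O_{n−a}(a) = p(n − a).
-- These recurrences at n, n − a and n − 2a give the identity by induction on n.

module Submission where

open import Defs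
open import Data.Bool using (true; false)
open import Data.Empty using (⊥-elim)
open import Data.List using (List; []; _∷_; map; filter; length)
open import Data.List.Membership.Propositional using (_∈_)
open import Data.List.Membership.Propositional.Properties
  using (∈-filter⁺; ∈-filter⁻; ∈-map⁺; ∈-map⁻)
open import Data.List.Membership.Propositional.Properties.WithK using (unique∧set⇒bag)
open import Data.List.Properties using (map-∘; length-map)
open import Data.List.Relation.Binary.BagAndSetEquality using (∼bag⇒↭)
open import Data.List.Relation.Binary.Permutation.Propositional using (_↭_)
open import Data.List.Relation.Binary.Permutation.Propositional.Properties as ↭ using (↭-length)
open import Data.List.Relation.Unary.All as All using ()
open import Data.List.Relation.Unary.All.Properties as All using ()
open import Data.List.Relation.Unary.AllPairs using ([]; _∷_)
open import Data.List.Relation.Unary.Any using (here; there)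
open import Data.List.Relation.Unary.Unique.Propositional using (Unique)
import Data.List.Relation.Unary.Unique.Propositional.Properties as Unique
open import Data.Nat
  using (ℕ; zero; suc; _+_; _*_; _∸_; _≤_; _<_; _≥_; z≤n; s≤s; s≤s⁻¹; _≟_; _≤?_; _<?_; >-nonZero)
open import Data.Nat.Divisibility
  using (_∣_; _∣?_; ∣-trans; ∣m+n∣m⇒∣n; ∣1⇒≡1; m∣m*n; *-monoʳ-∣; *-cancelˡ-∣)
open import Data.Nat.Induction using (<-rec)
open import Data.Nat.ListAction using (sum)
open import Data.Nat.ListAction.Properties using (sum-↭)
open import Data.Nat.Properties
open import Algebra.Properties.CommutativeSemigroup +-commutativeSemigroup
  using (x∙yz≈y∙xz) renaming (interchange to +-interchange)
open import Data.Nat.Tactic.RingSolver using (solve-∀)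
open import Data.Product using (_×_; _,_; proj₂)
open import Function using (_∘_)
open import Function.Bundles using (_⇔_; mk⇔; Equivalence)
open import Level using (0ℓ)
open import Relation.Binary.PropositionalEquality
open import Relation.Nullary using (¬_; yes; no; ¬?)
open import Relation.Nullary.Decidable using (dec-no)
open import Relation.Unary using (Pred; Decidable)

open Equivalence using (to; from)

private
  variable
    A : Set
    xs ys : List A

∑ : (A → ℕ) → List A → ℕ
∑ f xs = sum (map f xs)

∑-cong : {f g : A → ℕ} (xs : List A) → (∀ {x} → x ∈ xs → f x ≡ g x) → ∑ f xs ≡ ∑ g xs
∑-cong []       f≗g = refl
∑-cong (x ∷ xs) f≗g = cong₂ _+_ (f≗g (here refl)) (∑-cong xs (f≗g ∘ there))

∑-≡0 : {f : A → ℕ} (xs : List A) → (∀ {x} → x ∈ xs → f x ≡ 0) → ∑ f xs ≡ 0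
∑-≡0 []       f≡0 = refl
∑-≡0 (x ∷ xs) f≡0 = cong₂ _+_ (f≡0 (here refl)) (∑-≡0 xs (f≡0 ∘ there))

∑-+ : (f g : A → ℕ) (xs : List A) → ∑ (λ x → f x + g x) xs ≡ ∑ f xs + ∑ g xs
∑-+ f g []       = refl
∑-+ f g (x ∷ xs) = trans (cong ((f x + g x) +_) (∑-+ f g xs)) (+-interchange (f x) (g x) _ _)

∑-*ˡ : (c : ℕ) (g : A → ℕ) (xs : List A) → ∑ (λ x → c * g x) xs ≡ c * ∑ g xs
∑-*ˡ c g []       = sym (*-zeroʳ c)
∑-*ˡ c g (x ∷ xs) = trans (cong (c * g x +_) (∑-*ˡ c g xs)) (sym (*-distribˡ-+ c (g x) _))

∑-suc : (g : A → ℕ) (xs : List A) → ∑ (suc ∘ g) xs ≡ length xs + ∑ g xs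
∑-suc g []       = refl
∑-suc g (x ∷ xs) = cong suc (trans (cong (g x +_) (∑-suc g xs)) (x∙yz≈y∙xz (g x) (length xs) (∑ g xs)))

∑-map : {B : Set} (f : B → ℕ) (g : A → B) (xs : List A) → ∑ f (map g xs) ≡ ∑ (f ∘ g) xs
∑-map f g xs = cong sum (sym (map-∘ xs))

module _ {P : Pred A 0ℓ} (P? : Decidable P) where

  ∑-filter : (f : A → ℕ) (xs : List A) → (∀ {x} → x ∈ xs → ¬ P x → f x ≡ 0) →
    ∑ f xs ≡ ∑ f (filter P? xs)
  ∑-filter f []       f≡0 = refl
  ∑-filter f (x ∷ xs) f≡0 with P? x
  ... | yes _  = cong (f x +_) (∑-filter f xs (f≡0 ∘ there))
  ... | no ¬px = cong₂ _+_ (f≡0 (here refl) ¬px) (∑-filter f xs (f≡0 ∘ there))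

  length-filter+length-filter-¬ : (xs : List A) →
    length (filter P? xs) + length (filter (¬? ∘ P?) xs) ≡ length xs
  length-filter+length-filter-¬ []       = refl
  length-filter+length-filter-¬ (x ∷ xs) with P? x
  ... | yes _ = cong suc (length-filter+length-filter-¬ xs)
  ... | no  _ = trans (+-suc _ _) (cong suc (length-filter+length-filter-¬ xs))

∑-≤1 : (f : A → ℕ) (1≤f? : Decidable (λ x → 1 ≤ f x)) (xs : List A) →
  (∀ {x} → x ∈ xs → f x ≤ 1) → ∑ f xs ≡ length (filter 1≤f? xs)
∑-≤1 f 1≤f? []       f≤1 = refl
∑-≤1 f 1≤f? (x ∷ xs) f≤1 with 1≤f? x
... | yes 1≤fx = cong₂ _+_ (≤-antisym (f≤1 (here refl)) 1≤fx) (∑-≤1 f 1≤f? xs (f≤1 ∘ there))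
... | no  1≰fx = cong₂ _+_ (n<1⇒n≡0 (≰⇒> 1≰fx)) (∑-≤1 f 1≤f? xs (f≤1 ∘ there))

unique-map⁺ : {B : Set} (f : A → B) → (∀ {x y} → x ∈ xs → y ∈ xs → f x ≡ f y → x ≡ y) →
  Unique xs → Unique (map f xs)
unique-map⁺ f inj []         = []
unique-map⁺ f inj (x≢ ∷ xs!) =
  All.map⁺ (All.tabulate λ y∈ fx≡fy → All.lookup x≢ y∈ (inj (here refl) (there y∈) fx≡fy))
  ∷ unique-map⁺ f (λ x∈ y∈ → inj (there x∈) (there y∈)) xs!

Enumerates : (A → Set) → List A → Set
Enumerates P xs = Unique xs × (∀ x → x ∈ xs ⇔ P x)

module _ {P : A → Set} where

  enumerations-↭ : Enumerates P xs → Enumerates P ys → xs ↭ ys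
  enumerations-↭ (xs! , xs⇔) (ys! , ys⇔) = ∼bag⇒↭ (unique∧set⇒bag xs! ys!
    λ {z} → mk⇔ (from (ys⇔ z) ∘ to (xs⇔ z)) (from (xs⇔ z) ∘ to (ys⇔ z)))

  ∑-enumerations : (f : A → ℕ) → Enumerates P xs → Enumerates P ys → ∑ f xs ≡ ∑ f ys
  ∑-enumerations f exs eys = sum-↭ (↭.map⁺ f (enumerations-↭ exs eys))

  length-enumerations : Enumerates P xs → Enumerates P ys → length xs ≡ length ys
  length-enumerations exs eys = ↭-length (enumerations-↭ exs eys)

  enumerates-filter : {Q : Pred A 0ℓ} (Q? : Decidable Q) →
    Enumerates P xs → Enumerates (λ x → P x × Q x) (filter Q? xs)
  enumerates-filter Q? (xs! , xs⇔) = Unique.filter⁺ Q? xs! , λ x → mk⇔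
    (λ x∈ → let (x∈xs , qx) = ∈-filter⁻ Q? x∈ in to (xs⇔ x) x∈xs , qx)
    (λ (px , qx) → ∈-filter⁺ Q? (from (xs⇔ x) px) qx)

  enumerates-map : {B : Set} {R : B → Set} (g : A → B) (h : B → A) →
    (∀ {x} → P x → R (g x)) → (∀ {y} → R y → P (h y)) →
    (∀ {x} → P x → h (g x) ≡ x) → (∀ {y} → R y → g (h y) ≡ y) →
    Enumerates P xs → Enumerates R (map g xs)
  enumerates-map {R = R} g h g∈R h∈P h∘g g∘h (xs! , xs⇔) =
    unique , λ y → mk⇔ (member⇒R y) (R⇒member y)
    where
    unique : Unique (map g _)
    unique = unique-map⁺ g (λ {x} {x′} x∈ x′∈ gx≡gx′ → begin
      x        ≡⟨ h∘g (to (xs⇔ x) x∈) ⟨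
      h (g x)  ≡⟨ cong h gx≡gx′ ⟩
      h (g x′) ≡⟨ h∘g (to (xs⇔ x′) x′∈) ⟩
      x′       ∎) xs!
      where open ≡-Reasoning
    member⇒R : ∀ y → y ∈ map g _ → R y
    member⇒R y y∈ with ∈-map⁻ g y∈
    ... | x , x∈ , refl = g∈R (to (xs⇔ x) x∈)
    R⇒member : ∀ y → R y → y ∈ map g _
    R⇒member y ry = subst (_∈ map g _) (g∘h ry) (∈-map⁺ g (from (xs⇔ (h y)) (h∈P ry)))

-- Counting, inserting and removing parts of a given size

δ : ℕ → ℕ → ℕ
δ a b with a ≟ b
... | yes _ = 1
... | no  _ = 0

δ-refl : ∀ a → δ a a ≡ 1
δ-refl a rewrite ≟-diag (refl {x = a}) = refl

δ-≢ : ∀ {a b} → a ≢ b → δ a b ≡ 0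
δ-≢ {a} {b} a≢b rewrite dec-no (a ≟ b) a≢b = refl

δ≤1 : ∀ a b → δ a b ≤ 1
δ≤1 a b with a ≟ b
... | yes _ = ≤-refl
... | no  _ = z≤n

countNov : ℕ → List Part → ℕ
countNov a []                 = 0
countNov a ((b , false) ∷ ps) = δ a b + countNov a ps
countNov a ((b , true)  ∷ ps) = countNov a ps

countOv : ℕ → List Part → ℕ
countOv a []                 = 0
countOv a ((b , true)  ∷ ps) = δ a b + countOv a ps
countOv a ((b , false) ∷ ps) = countOv a ps

-- A new non-overlined a goes after an overlined a, which must remain the first occurrence of a;
-- a new overlined a goes before every part equal to a.
insertNov : ℕ → List Part → List Part
insertNov a [] = (a , false) ∷ []
insertNov a ((b , true) ∷ ps) with a ≤? b
... | yes _ = (b , true) ∷ insertNov a ps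
... | no  _ = (a , false) ∷ (b , true) ∷ ps
insertNov a ((b , false) ∷ ps) with a <? b
... | yes _ = (b , false) ∷ insertNov a ps
... | no  _ = (a , false) ∷ (b , false) ∷ ps

insertOv : ℕ → List Part → List Part
insertOv a [] = (a , true) ∷ []
insertOv a ((b , y) ∷ ps) with a <? b
... | yes _ = (b , y) ∷ insertOv a ps
... | no  _ = (a , true) ∷ (b , y) ∷ ps

removeNov : ℕ → List Part → List Part
removeNov a [] = []
removeNov a ((b , true) ∷ ps) = (b , true) ∷ removeNov a ps
removeNov a ((b , false) ∷ ps) with a ≟ b
... | yes _ = ps
... | no  _ = (b , false) ∷ removeNov a ps

removeOv : ℕ → List Part → List Part
removeOv a [] = []
removeOv a ((b , false) ∷ ps) = (b , false) ∷ removeOv a ps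
removeOv a ((b , true) ∷ ps) with a ≟ b
... | yes _ = ps
... | no  _ = (b , true) ∷ removeOv a ps

countNov-insertNov : ∀ a ps → countNov a (insertNov a ps) ≡ suc (countNov a ps)
countNov-insertNov a [] = cong (_+ 0) (δ-refl a)
countNov-insertNov a ((b , true) ∷ ps) with a ≤? b
... | yes _ = countNov-insertNov a ps
... | no  _ = cong (_+ countNov a ps) (δ-refl a)
countNov-insertNov a ((b , false) ∷ ps) with a <? b
... | yes _ = trans (cong (δ a b +_) (countNov-insertNov a ps)) (+-suc (δ a b) _)
... | no  _ = cong (_+ (δ a b + countNov a ps)) (δ-refl a)

countOv-insertOv : ∀ a ps → countOv a (insertOv a ps) ≡ suc (countOv a ps)
countOv-insertOv a [] = cong (_+ 0) (δ-refl a)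
countOv-insertOv a ((b , true) ∷ ps) with a <? b
... | yes _ = trans (cong (δ a b +_) (countOv-insertOv a ps)) (+-suc (δ a b) _)
... | no  _ = cong (_+ (δ a b + countOv a ps)) (δ-refl a)
countOv-insertOv a ((b , false) ∷ ps) with a <? b
... | yes _ = countOv-insertOv a ps
... | no  _ = cong (_+ countOv a ps) (δ-refl a)

sizeSum-insertNov : ∀ a ps → sizeSum (insertNov a ps) ≡ a + sizeSum ps
sizeSum-insertNov a [] = refl
sizeSum-insertNov a ((b , true) ∷ ps) with a ≤? b
... | yes _ = trans (cong (b +_) (sizeSum-insertNov a ps)) (x∙yz≈y∙xz b a _)
... | no  _ = refl
sizeSum-insertNov a ((b , false) ∷ ps) with a <? b
... | yes _ = trans (cong (b +_) (sizeSum-insertNov a ps)) (x∙yz≈y∙xz b a _)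
... | no  _ = refl

sizeSum-insertOv : ∀ a ps → sizeSum (insertOv a ps) ≡ a + sizeSum ps
sizeSum-insertOv a [] = refl
sizeSum-insertOv a ((b , y) ∷ ps) with a <? b
... | yes _ = trans (cong (b +_) (sizeSum-insertOv a ps)) (x∙yz≈y∙xz b a _)
... | no  _ = refl

removeNov-insertNov : ∀ a ps → removeNov a (insertNov a ps) ≡ ps
removeNov-insertNov a [] rewrite ≟-diag (refl {x = a}) = refl
removeNov-insertNov a ((b , true) ∷ ps) with a ≤? b
... | yes _ = cong ((b , true) ∷_) (removeNov-insertNov a ps)
... | no  _ rewrite ≟-diag (refl {x = a}) = refl
removeNov-insertNov a ((b , false) ∷ ps) with a <? b
... | yes a<b rewrite dec-no (a ≟ b) (<⇒≢ a<b) = cong ((b , false) ∷_) (removeNov-insertNov a ps)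
... | no  _   rewrite ≟-diag (refl {x = a}) = refl

removeOv-insertOv : ∀ a ps → removeOv a (insertOv a ps) ≡ ps
removeOv-insertOv a [] rewrite ≟-diag (refl {x = a}) = refl
removeOv-insertOv a ((b , false) ∷ ps) with a <? b
... | yes _ = cong ((b , false) ∷_) (removeOv-insertOv a ps)
... | no  _ rewrite ≟-diag (refl {x = a}) = refl
removeOv-insertOv a ((b , true) ∷ ps) with a <? b
... | yes a<b rewrite dec-no (a ≟ b) (<⇒≢ a<b) = cong ((b , true) ∷_) (removeOv-insertOv a ps)
... | no  _   rewrite ≟-diag (refl {x = a}) = refl

wellFormed-tail : ∀ {p ps} → WellFormed (p ∷ ps) → WellFormed ps
wellFormed-tail wf-one         = wf-[]
wellFormed-tail (wf-two _ _ w) = w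

wellFormed-drop-second : ∀ {p q ps} → WellFormed (p ∷ q ∷ ps) → WellFormed (p ∷ ps)
wellFormed-drop-second {ps = []} (wf-two _ _ _) = wf-one
wellFormed-drop-second {ps = _ ∷ _} (wf-two {b = b} a≥b a≡b⇒q (wf-two b≥c b≡c⇒r w)) =
  wf-two (≤-trans b≥c a≥b) (λ a≡c → b≡c⇒r (≤-antisym (subst (b ≤_) a≡c a≥b) b≥c)) w

wellFormed-∈⇒≤-head : ∀ {b y c z ps} → WellFormed ((b , y) ∷ ps) → (c , z) ∈ ps → c ≤ b
wellFormed-∈⇒≤-head (wf-two b≥c _ _) (here refl) = b≥c
wellFormed-∈⇒≤-head (wf-two b≥d _ w) (there c∈)  = ≤-trans (wellFormed-∈⇒≤-head w c∈) b≥d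

countNov⇒∈ : ∀ a ps → 1 ≤ countNov a ps → (a , false) ∈ ps
countNov⇒∈ a ((b , true) ∷ ps) 1≤c = there (countNov⇒∈ a ps 1≤c)
countNov⇒∈ a ((b , false) ∷ ps) 1≤c with a ≟ b
... | yes refl = here refl
... | no  _    = there (countNov⇒∈ a ps 1≤c)

countOv⇒∈ : ∀ a ps → 1 ≤ countOv a ps → (a , true) ∈ ps
countOv⇒∈ a ((b , false) ∷ ps) 1≤c = there (countOv⇒∈ a ps 1≤c)
countOv⇒∈ a ((b , true) ∷ ps) 1≤c with a ≟ b
... | yes refl = here refl
... | no  _    = there (countOv⇒∈ a ps 1≤c)

countOv-after-≤ : ∀ a {b y} ps → WellFormed ((b , y) ∷ ps) → b ≤ a → countOv a ps ≡ 0
countOv-after-≤ a [] _ _ = refl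
countOv-after-≤ a ((c , false) ∷ ps) (wf-two b≥c _ w) b≤a = countOv-after-≤ a ps w (≤-trans b≥c b≤a)
countOv-after-≤ a {b} ((c , true) ∷ ps) (wf-two b≥c b≡c⇒false w) b≤a =
  cong₂ _+_ (δ-≢ a≢c) (countOv-after-≤ a ps w (≤-trans b≥c b≤a))
  where
  a≢c : a ≢ c
  a≢c refl with () ← b≡c⇒false (≤-antisym b≤a b≥c)

countOv≤1 : ∀ a ps → WellFormed ps → countOv a ps ≤ 1
countOv≤1 a [] _ = z≤n
countOv≤1 a ((b , y) ∷ ps) w with b ≤? a
countOv≤1 a ((b , true) ∷ ps) w | yes b≤a rewrite countOv-after-≤ a ps w b≤a =
  subst (_≤ 1) (sym (+-identityʳ (δ a b))) (δ≤1 a b)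
countOv≤1 a ((b , false) ∷ ps) w | yes b≤a rewrite countOv-after-≤ a ps w b≤a = z≤n
countOv≤1 a ((b , true) ∷ ps) w | no b≰a rewrite δ-≢ (λ a≡b → b≰a (≤-reflexive (sym a≡b))) =
  countOv≤1 a ps (wellFormed-tail w)
countOv≤1 a ((b , false) ∷ ps) w | no _ = countOv≤1 a ps (wellFormed-tail w)

insertNov-removeNov : ∀ a ps → WellFormed ps → 1 ≤ countNov a ps → insertNov a (removeNov a ps) ≡ ps
insertNov-removeNov a ((b , true) ∷ ps) w 1≤c with a ≤? b
... | yes _   = cong ((b , true) ∷_) (insertNov-removeNov a ps (wellFormed-tail w) 1≤c)
... | no  a≰b = ⊥-elim (a≰b (wellFormed-∈⇒≤-head w (countNov⇒∈ a ps 1≤c)))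
insertNov-removeNov a ((b , false) ∷ ps) w 1≤c with a ≟ b
insertNov-removeNov a ((a , false) ∷ []) w 1≤c | yes refl = refl
insertNov-removeNov a ((a , false) ∷ (c , true) ∷ ps) (wf-two a≥c a≡c⇒false _) 1≤c | yes refl
  with a ≤? c
... | yes a≤c with () ← a≡c⇒false (≤-antisym a≤c a≥c)
... | no  _   = refl
insertNov-removeNov a ((a , false) ∷ (c , false) ∷ ps) (wf-two a≥c _ _) 1≤c | yes refl
  with a <? c
... | yes a<c = ⊥-elim (<⇒≱ a<c a≥c)
... | no  _   = refl
insertNov-removeNov a ((b , false) ∷ ps) w 1≤c | no a≢b with a <? b
... | yes _   = cong ((b , false) ∷_) (insertNov-removeNov a ps (wellFormed-tail w) 1≤c)
... | no  a≮b = ⊥-elim (a≮b (≤∧≢⇒< (wellFormed-∈⇒≤-head w (countNov⇒∈ a ps 1≤c)) a≢b))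

insertOv-removeOv : ∀ a ps → WellFormed ps → 1 ≤ countOv a ps → insertOv a (removeOv a ps) ≡ ps
insertOv-removeOv a ((b , false) ∷ ps) w 1≤c with a <? b
... | yes _   = cong ((b , false) ∷_) (insertOv-removeOv a ps (wellFormed-tail w) 1≤c)
... | no  a≮b = ⊥-elim (a≮b (≤∧≢⇒< (wellFormed-∈⇒≤-head w (countOv⇒∈ a ps 1≤c)) a≢b))
  where
  a≢b : a ≢ b
  a≢b refl = <⇒≱ 1≤c (≤-reflexive (countOv-after-≤ a ps w ≤-refl))
insertOv-removeOv a ((b , true) ∷ ps) w 1≤c with a ≟ b
insertOv-removeOv a ((a , true) ∷ []) w 1≤c | yes refl = refl
insertOv-removeOv a ((a , true) ∷ (c , y) ∷ ps) (wf-two a≥c _ _) 1≤c | yes refl with a <? c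
... | yes a<c = ⊥-elim (<⇒≱ a<c a≥c)
... | no  _   = refl
insertOv-removeOv a ((b , true) ∷ ps) w 1≤c | no a≢b with a <? b
... | yes _   = cong ((b , true) ∷_) (insertOv-removeOv a ps (wellFormed-tail w) 1≤c)
... | no  a≮b = ⊥-elim (a≮b (≤∧≢⇒< (wellFormed-∈⇒≤-head w (countOv⇒∈ a ps 1≤c)) a≢b))

removeNov-wellFormed-below : ∀ a {p} ps → WellFormed (p ∷ ps) → WellFormed (p ∷ removeNov a ps)
removeNov-wellFormed-below a [] w = w
removeNov-wellFormed-below a ((b , true) ∷ ps) (wf-two ge eq⇒ w) =
  wf-two ge eq⇒ (removeNov-wellFormed-below a ps w)
removeNov-wellFormed-below a ((b , false) ∷ ps) w with a ≟ b
... | yes _ = wellFormed-drop-second w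
removeNov-wellFormed-below a ((b , false) ∷ ps) (wf-two ge eq⇒ w) | no _ =
  wf-two ge eq⇒ (removeNov-wellFormed-below a ps w)

removeNov-wellFormed : ∀ a ps → WellFormed ps → WellFormed (removeNov a ps)
removeNov-wellFormed a [] w = w
removeNov-wellFormed a ((b , true) ∷ ps) w = removeNov-wellFormed-below a ps w
removeNov-wellFormed a ((b , false) ∷ ps) w with a ≟ b
... | yes _ = wellFormed-tail w
... | no  _ = removeNov-wellFormed-below a ps w

removeOv-wellFormed-below : ∀ a {p} ps → WellFormed (p ∷ ps) → WellFormed (p ∷ removeOv a ps)
removeOv-wellFormed-below a [] w = w
removeOv-wellFormed-below a ((b , false) ∷ ps) (wf-two ge eq⇒ w) =
  wf-two ge eq⇒ (removeOv-wellFormed-below a ps w)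
removeOv-wellFormed-below a ((b , true) ∷ ps) w with a ≟ b
... | yes _ = wellFormed-drop-second w
removeOv-wellFormed-below a ((b , true) ∷ ps) (wf-two ge eq⇒ w) | no _ =
  wf-two ge eq⇒ (removeOv-wellFormed-below a ps w)

removeOv-wellFormed : ∀ a ps → WellFormed ps → WellFormed (removeOv a ps)
removeOv-wellFormed a [] w = w
removeOv-wellFormed a ((b , false) ∷ ps) w = removeOv-wellFormed-below a ps w
removeOv-wellFormed a ((b , true) ∷ ps) w with a ≟ b
... | yes _ = wellFormed-tail w
... | no  _ = removeOv-wellFormed-below a ps w

insertNov-wellFormed-below : ∀ a {c x} ps → a ≤ c → WellFormed ((c , x) ∷ ps) →
  WellFormed ((c , x) ∷ insertNov a ps)
insertNov-wellFormed-below a [] a≤c wf-one = wf-two a≤c (λ _ → refl) wf-one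
insertNov-wellFormed-below a ((b , true) ∷ ps) a≤c (wf-two c≥b c≡b⇒ w) with a ≤? b
... | yes a≤b = wf-two c≥b c≡b⇒ (insertNov-wellFormed-below a ps a≤b w)
... | no  a≰b = wf-two a≤c (λ _ → refl) (wf-two (≰⇒≥ a≰b) (⊥-elim ∘ a≰b ∘ ≤-reflexive) w)
insertNov-wellFormed-below a ((b , false) ∷ ps) a≤c (wf-two c≥b c≡b⇒ w) with a <? b
... | yes a<b = wf-two c≥b c≡b⇒ (insertNov-wellFormed-below a ps (<⇒≤ a<b) w)
... | no  a≮b = wf-two a≤c (λ _ → refl) (wf-two (≮⇒≥ a≮b) (λ _ → refl) w)

insertNov-wellFormed : ∀ a ps → WellFormed ps → WellFormed (insertNov a ps)
insertNov-wellFormed a [] w = wf-one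
insertNov-wellFormed a ((b , true) ∷ ps) w with a ≤? b
... | yes a≤b = insertNov-wellFormed-below a ps a≤b w
... | no  a≰b = wf-two (≰⇒≥ a≰b) (⊥-elim ∘ a≰b ∘ ≤-reflexive) w
insertNov-wellFormed a ((b , false) ∷ ps) w with a <? b
... | yes a<b = insertNov-wellFormed-below a ps (<⇒≤ a<b) w
... | no  a≮b = wf-two (≮⇒≥ a≮b) (λ _ → refl) w

countOv≡0-tail : ∀ a {b} y ps → countOv a ((b , y) ∷ ps) ≡ 0 → countOv a ps ≡ 0
countOv≡0-tail a {b} true  ps c≡0 = m+n≡0⇒n≡0 (δ a b) c≡0
countOv≡0-tail a     false ps c≡0 = c≡0

countOv≡0-head : ∀ a {b y} ps → countOv a ((b , y) ∷ ps) ≡ 0 → a ≡ b → y ≡ false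
countOv≡0-head a {y = false} ps _   _    = refl
countOv≡0-head a {y = true}  ps c≡0 refl with () ← trans (cong (_+ countOv a ps) (sym (δ-refl a))) c≡0

insertOv-wellFormed-below : ∀ a {c x} ps → a < c → countOv a ps ≡ 0 → WellFormed ((c , x) ∷ ps) →
  WellFormed ((c , x) ∷ insertOv a ps)
insertOv-wellFormed-below a [] a<c _ wf-one = wf-two (<⇒≤ a<c) (⊥-elim ∘ <⇒≢ a<c ∘ sym) wf-one
insertOv-wellFormed-below a ((b , y) ∷ ps) a<c c≡0 (wf-two c≥b c≡b⇒ w) with a <? b
... | yes a<b = wf-two c≥b c≡b⇒ (insertOv-wellFormed-below a ps a<b (countOv≡0-tail a y ps c≡0) w)
... | no  a≮b = wf-two (<⇒≤ a<c) (⊥-elim ∘ <⇒≢ a<c ∘ sym)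
                  (wf-two (≮⇒≥ a≮b) (countOv≡0-head a ps c≡0) w)

insertOv-wellFormed : ∀ a ps → countOv a ps ≡ 0 → WellFormed ps → WellFormed (insertOv a ps)
insertOv-wellFormed a [] _ _ = wf-one
insertOv-wellFormed a ((b , y) ∷ ps) c≡0 w with a <? b
... | yes a<b = insertOv-wellFormed-below a ps a<b (countOv≡0-tail a y ps c≡0) w
... | no  a≮b = wf-two (≮⇒≥ a≮b) (countOv≡0-head a ps c≡0) w

insertNov-positive : ∀ a ps → a ≥ 1 → AllPositive ps → AllPositive (insertNov a ps)
insertNov-positive a [] a≥1 _ = ap-∷ a≥1 ap-[]
insertNov-positive a ((b , true) ∷ ps) a≥1 (ap-∷ b≥1 ps⁺) with a ≤? b
... | yes _ = ap-∷ b≥1 (insertNov-positive a ps a≥1 ps⁺)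
... | no  _ = ap-∷ a≥1 (ap-∷ b≥1 ps⁺)
insertNov-positive a ((b , false) ∷ ps) a≥1 (ap-∷ b≥1 ps⁺) with a <? b
... | yes _ = ap-∷ b≥1 (insertNov-positive a ps a≥1 ps⁺)
... | no  _ = ap-∷ a≥1 (ap-∷ b≥1 ps⁺)

insertOv-positive : ∀ a ps → a ≥ 1 → AllPositive ps → AllPositive (insertOv a ps)
insertOv-positive a [] a≥1 _ = ap-∷ a≥1 ap-[]
insertOv-positive a ((b , y) ∷ ps) a≥1 (ap-∷ b≥1 ps⁺) with a <? b
... | yes _ = ap-∷ b≥1 (insertOv-positive a ps a≥1 ps⁺)
... | no  _ = ap-∷ a≥1 (ap-∷ b≥1 ps⁺)

removeNov-positive : ∀ a ps → AllPositive ps → AllPositive (removeNov a ps)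
removeNov-positive a [] ps⁺ = ps⁺
removeNov-positive a ((b , true) ∷ ps) (ap-∷ b≥1 ps⁺) = ap-∷ b≥1 (removeNov-positive a ps ps⁺)
removeNov-positive a ((b , false) ∷ ps) (ap-∷ b≥1 ps⁺) with a ≟ b
... | yes _ = ps⁺
... | no  _ = ap-∷ b≥1 (removeNov-positive a ps ps⁺)

removeOv-positive : ∀ a ps → AllPositive ps → AllPositive (removeOv a ps)
removeOv-positive a [] ps⁺ = ps⁺
removeOv-positive a ((b , false) ∷ ps) (ap-∷ b≥1 ps⁺) = ap-∷ b≥1 (removeOv-positive a ps ps⁺)
removeOv-positive a ((b , true) ∷ ps) (ap-∷ b≥1 ps⁺) with a ≟ b
... | yes _ = ps⁺
... | no  _ = ap-∷ b≥1 (removeOv-positive a ps ps⁺)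

open IsOverpartition

sizeSum≡∸ : ∀ {a n} ps → a + sizeSum ps ≡ n → sizeSum ps ≡ n ∸ a
sizeSum≡∸ {a} ps eq = trans (sym (m+n∸m≡n a (sizeSum ps))) (cong (_∸ a) eq)

removeNov-isOverpartition : ∀ {a n x} → IsOverpartition n x → 1 ≤ countNov a x →
  IsOverpartition (n ∸ a) (removeNov a x)
removeNov-isOverpartition {a} {n} {x} o 1≤c = record
  { positive   = removeNov-positive a x (positive o)
  ; wellFormed = removeNov-wellFormed a x (wellFormed o)
  ; sumsTo     = sizeSum≡∸ (removeNov a x) (begin
      a + sizeSum (removeNov a x)         ≡⟨ sizeSum-insertNov a (removeNov a x) ⟨
      sizeSum (insertNov a (removeNov a x)) ≡⟨ cong sizeSum (insertNov-removeNov a x (wellFormed o) 1≤c) ⟩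
      sizeSum x                           ≡⟨ sumsTo o ⟩
      n                                   ∎)
  }
  where open ≡-Reasoning

removeOv-isOverpartition : ∀ {a n x} → IsOverpartition n x → 1 ≤ countOv a x →
  IsOverpartition (n ∸ a) (removeOv a x)
removeOv-isOverpartition {a} {n} {x} o 1≤c = record
  { positive   = removeOv-positive a x (positive o)
  ; wellFormed = removeOv-wellFormed a x (wellFormed o)
  ; sumsTo     = sizeSum≡∸ (removeOv a x) (begin
      a + sizeSum (removeOv a x)          ≡⟨ sizeSum-insertOv a (removeOv a x) ⟨
      sizeSum (insertOv a (removeOv a x)) ≡⟨ cong sizeSum (insertOv-removeOv a x (wellFormed o) 1≤c) ⟩
      sizeSum x                           ≡⟨ sumsTo o ⟩
      n                                   ∎)
  }
  where open ≡-Reasoning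

insertNov-isOverpartition : ∀ {a n x} → a ≥ 1 → a ≤ n → IsOverpartition (n ∸ a) x →
  IsOverpartition n (insertNov a x)
insertNov-isOverpartition {a} {x = x} a≥1 a≤n o = record
  { positive   = insertNov-positive a x a≥1 (positive o)
  ; wellFormed = insertNov-wellFormed a x (wellFormed o)
  ; sumsTo     = trans (sizeSum-insertNov a x) (trans (cong (a +_) (sumsTo o)) (m+[n∸m]≡n a≤n))
  }

insertOv-isOverpartition : ∀ {a n x} → a ≥ 1 → a ≤ n → IsOverpartition (n ∸ a) x →
  countOv a x ≡ 0 →  IsOverpartition n (insertOv a x)
insertOv-isOverpartition {a} {x = x} a≥1 a≤n o c≡0 = record
  { positive   = insertOv-positive a x a≥1 (positive o)
  ; wellFormed = insertOv-wellFormed a x c≡0 (wellFormed o)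
  ; sumsTo     = trans (sizeSum-insertOv a x) (trans (cong (a +_) (sumsTo o)) (m+[n∸m]≡n a≤n))
  }

countOv-removeOv : ∀ a x → WellFormed x → 1 ≤ countOv a x → countOv a (removeOv a x) ≡ 0
countOv-removeOv a x w 1≤c = n<1⇒n≡0 (begin
  suc (countOv a (removeOv a x))        ≡⟨ countOv-insertOv a (removeOv a x) ⟨
  countOv a (insertOv a (removeOv a x)) ≡⟨ cong (countOv a) (insertOv-removeOv a x w 1≤c) ⟩
  countOv a x                           ≤⟨ countOv≤1 a x w ⟩
  1                                     ∎)
  where open ≤-Reasoning

HasNov HasOv : ℕ → List Part → Set
HasNov a x = 1 ≤ countNov a x
HasOv  a x = 1 ≤ countOv a x

hasNov? : ∀ a → Decidable (HasNov a)
hasNov? a x = 1 ≤? countNov a x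

hasOv? : ∀ a → Decidable (HasOv a)
hasOv? a x = 1 ≤? countOv a x

Overpartitions : ℕ → List (List Part) → Set
Overpartitions n = Enumerates (IsOverpartition n)

removeNov-enumerates : ∀ {a n L} → a ≥ 1 → a ≤ n → Overpartitions n L →
  Overpartitions (n ∸ a) (map (removeNov a) (filter (hasNov? a) L))
removeNov-enumerates {a} a≥1 a≤n L-enum = enumerates-map (removeNov a) (insertNov a)
  (λ (o , 1≤c) → removeNov-isOverpartition o 1≤c)
  (λ {x} o → insertNov-isOverpartition a≥1 a≤n o , subst (1 ≤_) (sym (countNov-insertNov a x)) (s≤s z≤n))
  (λ {x} (o , 1≤c) → insertNov-removeNov a x (wellFormed o) 1≤c)
  (λ {x} _ → removeNov-insertNov a x)
  (enumerates-filter (hasNov? a) L-enum)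

removeOv-enumerates : ∀ {a n L} → a ≥ 1 → a ≤ n → Overpartitions n L →
  Enumerates (λ x → IsOverpartition (n ∸ a) x × ¬ HasOv a x) (map (removeOv a) (filter (hasOv? a) L))
removeOv-enumerates {a} a≥1 a≤n L-enum = enumerates-map (removeOv a) (insertOv a)
  (λ {x} (o , 1≤c) → removeOv-isOverpartition o 1≤c ,
                     <⇒≱ (s≤s (≤-reflexive (countOv-removeOv a x (wellFormed o) 1≤c))))
  (λ {x} (o , ¬has) → insertOv-isOverpartition a≥1 a≤n o (n<1⇒n≡0 (≰⇒> ¬has)) ,
                      subst (1 ≤_) (sym (countOv-insertOv a x)) (s≤s z≤n))
  (λ {x} (o , 1≤c) → insertOv-removeOv a x (wellFormed o) 1≤c)
  (λ {x} _ → removeOv-insertOv a x)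
  (enumerates-filter (hasOv? a) L-enum)

-- The identity O_n(a) + 2 N_n(2a) = N_n(a)

∑countNov-recurrence : ∀ {a n L L′} → a ≥ 1 → a ≤ n →
  Overpartitions n L → Overpartitions (n ∸ a) L′ →
  ∑ (countNov a) L ≡ length L′ + ∑ (countNov a) L′
∑countNov-recurrence {a} {L = L} {L′} a≥1 a≤n L-enum L′-enum = begin
  ∑ (countNov a) L
    ≡⟨ ∑-filter (hasNov? a) (countNov a) L (λ _ → n<1⇒n≡0 ∘ ≰⇒>) ⟩
  ∑ (countNov a) F
    ≡⟨ ∑-cong F count-after-removal ⟩
  ∑ (suc ∘ countNov a ∘ removeNov a) F
    ≡⟨ ∑-suc (countNov a ∘ removeNov a) F ⟩
  length F + ∑ (countNov a ∘ removeNov a) F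
    ≡⟨ cong₂ _+_ (length-map (removeNov a) F) (∑-map (countNov a) (removeNov a) F) ⟨
  length D + ∑ (countNov a) D
    ≡⟨ cong₂ _+_ (length-enumerations D-enum L′-enum) (∑-enumerations (countNov a) D-enum L′-enum) ⟩
  length L′ + ∑ (countNov a) L′ ∎
  where
  open ≡-Reasoning
  F = filter (hasNov? a) L
  D = map (removeNov a) F
  D-enum = removeNov-enumerates a≥1 a≤n L-enum
  count-after-removal : ∀ {x} → x ∈ F → countNov a x ≡ suc (countNov a (removeNov a x))
  count-after-removal {x} x∈F with x∈L , 1≤c ← ∈-filter⁻ (hasNov? a) x∈F = begin
    countNov a x
      ≡⟨ cong (countNov a) (insertNov-removeNov a x (wellFormed o) 1≤c) ⟨
    countNov a (insertNov a (removeNov a x))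
      ≡⟨ countNov-insertNov a (removeNov a x) ⟩
    suc (countNov a (removeNov a x)) ∎
    where o = to (proj₂ L-enum x) x∈L

∑countOv≡length-filter : ∀ {a n L} → Overpartitions n L → ∑ (countOv a) L ≡ length (filter (hasOv? a) L)
∑countOv≡length-filter {a} {L = L} (_ , L⇔) = ∑-≤1 (countOv a) (hasOv? a) L
  (λ {x} x∈L → countOv≤1 a x (wellFormed (to (L⇔ x) x∈L)))

∑countOv-recurrence : ∀ {a n L L′} → a ≥ 1 → a ≤ n →
  Overpartitions n L → Overpartitions (n ∸ a) L′ →
  ∑ (countOv a) L + ∑ (countOv a) L′ ≡ length L′
∑countOv-recurrence {a} {L = L} {L′} a≥1 a≤n L-enum L′-enum = begin
  ∑ (countOv a) L + ∑ (countOv a) L′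
    ≡⟨ cong₂ _+_ (∑countOv≡length-filter L-enum) (∑countOv≡length-filter L′-enum) ⟩
  length F + length (filter (hasOv? a) L′)
    ≡⟨ cong (_+ length (filter (hasOv? a) L′)) (length-map (removeOv a) F) ⟨
  length (map (removeOv a) F) + length (filter (hasOv? a) L′)
    ≡⟨ cong (_+ length (filter (hasOv? a) L′))
         (length-enumerations (removeOv-enumerates a≥1 a≤n L-enum)
                              (enumerates-filter (¬? ∘ hasOv? a) L′-enum)) ⟩
  length (filter (¬? ∘ hasOv? a) L′) + length (filter (hasOv? a) L′)
    ≡⟨ +-comm (length (filter (¬? ∘ hasOv? a) L′)) _ ⟩
  length (filter (hasOv? a) L′) + length (filter (¬? ∘ hasOv? a) L′)
    ≡⟨ length-filter+length-filter-¬ (hasOv? a) L′ ⟩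
  length L′ ∎
  where
  open ≡-Reasoning
  F = filter (hasOv? a) L

countNov-≡0 : ∀ a ps → sizeSum ps < a → countNov a ps ≡ 0
countNov-≡0 a [] _ = refl
countNov-≡0 a ((b , true) ∷ ps) s<a = countNov-≡0 a ps (≤-<-trans (m≤n+m _ b) s<a)
countNov-≡0 a ((b , false) ∷ ps) s<a =
  cong₂ _+_ (δ-≢ λ { refl → <-irrefl refl (≤-<-trans (m≤m+n a _) s<a) })
            (countNov-≡0 a ps (≤-<-trans (m≤n+m _ b) s<a))

countOv-≡0 : ∀ a ps → sizeSum ps < a → countOv a ps ≡ 0
countOv-≡0 a [] _ = refl
countOv-≡0 a ((b , false) ∷ ps) s<a = countOv-≡0 a ps (≤-<-trans (m≤n+m _ b) s<a)
countOv-≡0 a ((b , true) ∷ ps) s<a =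
  cong₂ _+_ (δ-≢ λ { refl → <-irrefl refl (≤-<-trans (m≤m+n a _) s<a) })
            (countOv-≡0 a ps (≤-<-trans (m≤n+m _ b) s<a))

∑countNov-vanishes : ∀ {a n L} → n < a → Overpartitions n L → ∑ (countNov a) L ≡ 0
∑countNov-vanishes {a} {L = L} n<a (_ , L⇔) =
  ∑-≡0 L λ {x} x∈L → countNov-≡0 a x (subst (_< a) (sym (sumsTo (to (L⇔ x) x∈L))) n<a)

∑countOv-vanishes : ∀ {a n L} → n < a → Overpartitions n L → ∑ (countOv a) L ≡ 0
∑countOv-vanishes {a} {L = L} n<a (_ , L⇔) =
  ∑-≡0 L λ {x} x∈L → countOv-≡0 a x (subst (_< a) (sym (sumsTo (to (L⇔ x) x∈L))) n<a)

CountIdentity : ℕ → ℕ → Set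
CountIdentity a n = ∀ {L} → Overpartitions n L →
  ∑ (countOv a) L + 2 * ∑ (countNov (2 * a)) L ≡ ∑ (countNov a) L

countIdentity-< : ∀ {a n} → n < a → CountIdentity a n
countIdentity-< {a} n<a {L} L-enum = begin
  ∑ (countOv a) L + 2 * ∑ (countNov (2 * a)) L
    ≡⟨ cong₂ (λ x y → x + 2 * y) (∑countOv-vanishes n<a L-enum)
                                  (∑countNov-vanishes (<-≤-trans n<a (m≤m+n a _)) L-enum) ⟩
  0 ≡⟨ ∑countNov-vanishes n<a L-enum ⟨
  ∑ (countNov a) L ∎
  where open ≡-Reasoning

countIdentity-<2* : ∀ {a n} → a ≥ 1 → a ≤ n → n < 2 * a → CountIdentity a n
countIdentity-<2* {a} {n} a≥1 a≤n n<2a {L} L-enum = begin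
  ∑ (countOv a) L + 2 * ∑ (countNov (2 * a)) L
    ≡⟨ cong (λ y → ∑ (countOv a) L + 2 * y) (∑countNov-vanishes n<2a L-enum) ⟩
  ∑ (countOv a) L + 0
    ≡⟨ cong (∑ (countOv a) L +_) (∑countOv-vanishes n∸a<a L₁-enum) ⟨
  ∑ (countOv a) L + ∑ (countOv a) L₁
    ≡⟨ ∑countOv-recurrence a≥1 a≤n L-enum L₁-enum ⟩
  length L₁
    ≡⟨ +-identityʳ (length L₁) ⟨
  length L₁ + 0
    ≡⟨ cong (length L₁ +_) (∑countNov-vanishes n∸a<a L₁-enum) ⟨
  length L₁ + ∑ (countNov a) L₁
    ≡⟨ ∑countNov-recurrence a≥1 a≤n L-enum L₁-enum ⟨
  ∑ (countNov a) L ∎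
  where
  open ≡-Reasoning
  L₁ = map (removeNov a) (filter (hasNov? a) L)
  L₁-enum = removeNov-enumerates a≥1 a≤n L-enum
  n∸a<a : n ∸ a < a
  n∸a<a = m<n+o⇒m∸n<o n a {{>-nonZero a≥1}} (subst (n <_) (cong (a +_) (+-identityʳ a)) n<2a)

countIdentity-≥2* : ∀ {a n} → a ≥ 1 → 2 * a ≤ n → CountIdentity a (n ∸ 2 * a) → CountIdentity a n
countIdentity-≥2* {a} {n} a≥1 2a≤n identity {L} L-enum = begin
  x + 2 * ∑ (countNov (2 * a)) L
    ≡⟨ cong (λ t → x + 2 * t) (∑countNov-recurrence 2a≥1 2a≤n L-enum L₂-enum′) ⟩
  x + 2 * (length L₂ + s)
    ≡⟨ cong (λ t → x + 2 * (t + s)) (∑countOv-recurrence a≥1 a≤n∸a L₁-enum L₂-enum) ⟨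
  x + 2 * ((y + z) + s)
    ≡⟨ regroup x y z s ⟩
  (x + y) + ((y + z) + (z + 2 * s))
    ≡⟨ cong₂ _+_ (∑countOv-recurrence a≥1 a≤n L-enum L₁-enum)
                 (cong₂ _+_ (∑countOv-recurrence a≥1 a≤n∸a L₁-enum L₂-enum) (identity L₂-enum′)) ⟩
  length L₁ + (length L₂ + ∑ (countNov a) L₂)
    ≡⟨ cong (length L₁ +_) (∑countNov-recurrence a≥1 a≤n∸a L₁-enum L₂-enum) ⟨
  length L₁ + ∑ (countNov a) L₁
    ≡⟨ ∑countNov-recurrence a≥1 a≤n L-enum L₁-enum ⟨
  ∑ (countNov a) L ∎
  where
  open ≡-Reasoning
  regroup : ∀ x y z s → x + 2 * ((y + z) + s) ≡ (x + y) + ((y + z) + (z + 2 * s))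
  regroup = solve-∀
  2a≡a+a : 2 * a ≡ a + a
  2a≡a+a = cong (a +_) (+-identityʳ a)
  2a≥1 = ≤-trans a≥1 (m≤m+n a _)
  a≤n = ≤-trans (m≤m+n a _) 2a≤n
  a≤n∸a = m+n≤o⇒m≤o∸n a (subst (_≤ n) 2a≡a+a 2a≤n)
  L₁ = map (removeNov a) (filter (hasNov? a) L)
  L₁-enum = removeNov-enumerates a≥1 a≤n L-enum
  L₂ = map (removeNov a) (filter (hasNov? a) L₁)
  L₂-enum = removeNov-enumerates a≥1 a≤n∸a L₁-enum
  L₂-enum′ : Overpartitions (n ∸ 2 * a) L₂
  L₂-enum′ = subst (λ m → Overpartitions m L₂)
                   (trans (∸-+-assoc n a a) (cong (n ∸_) (sym 2a≡a+a))) L₂-enum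
  x = ∑ (countOv a) L
  y = ∑ (countOv a) L₁
  z = ∑ (countOv a) L₂
  s = ∑ (countNov (2 * a)) L₂

countIdentity : ∀ {a} → a ≥ 1 → ∀ n → CountIdentity a n
countIdentity {a} a≥1 = <-rec (CountIdentity a) step
  where
  step : ∀ n → (∀ {m} → m < n → CountIdentity a m) → CountIdentity a n
  step n rec with n <? a | n <? 2 * a
  ... | yes n<a | _        = countIdentity-< n<a
  ... | no  n≮a | yes n<2a = countIdentity-<2* a≥1 (≮⇒≥ n≮a) n<2a
  ... | no  _   | no  n≮2a =
    countIdentity-≥2* a≥1 2a≤n (rec (∸-monoʳ-< {n} {2 * a} {0} (≤-trans a≥1 (m≤m+n a _)) 2a≤n))
    where 2a≤n = ≮⇒≥ n≮2a

-- Grouping parts by size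

sumBelow : ℕ → (ℕ → ℕ) → ℕ
sumBelow zero    h = 0
sumBelow (suc M) h = sumBelow M h + h M

sumBelow-cong : ∀ M {f g : ℕ → ℕ} → (∀ i → i < M → f i ≡ g i) → sumBelow M f ≡ sumBelow M g
sumBelow-cong zero    f≗g = refl
sumBelow-cong (suc M) f≗g =
  cong₂ _+_ (sumBelow-cong M (λ i i<M → f≗g i (m<n⇒m<1+n i<M))) (f≗g M ≤-refl)

sumBelow-≡0 : ∀ M {f : ℕ → ℕ} → (∀ i → i < M → f i ≡ 0) → sumBelow M f ≡ 0
sumBelow-≡0 zero    f≡0 = refl
sumBelow-≡0 (suc M) f≡0 =
  cong₂ _+_ (sumBelow-≡0 M (λ i i<M → f≡0 i (m<n⇒m<1+n i<M))) (f≡0 M ≤-refl)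

sumBelow-+ : ∀ M (f g : ℕ → ℕ) → sumBelow M (λ i → f i + g i) ≡ sumBelow M f + sumBelow M g
sumBelow-+ zero    f g = refl
sumBelow-+ (suc M) f g = trans (cong (_+ (f M + g M)) (sumBelow-+ M f g))
                               (+-interchange (sumBelow M f) (sumBelow M g) (f M) (g M))

*-δ-≢ : ∀ c {a b} → a ≢ b → c * δ a b ≡ 0
*-δ-≢ c a≢b = trans (cong (c *_) (δ-≢ a≢b)) (*-zeroʳ c)

sumBelow-δ : ∀ M (f : ℕ → ℕ) {b} → b < M → sumBelow M (λ a → f a * δ a b) ≡ f b
sumBelow-δ (suc M) f {b} b<1+M with b <? M
... | yes b<M = begin
  sumBelow M (λ a → f a * δ a b) + f M * δ M b
    ≡⟨ cong₂ _+_ (sumBelow-δ M f b<M) (*-δ-≢ (f M) (>⇒≢ b<M)) ⟩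
  f b + 0
    ≡⟨ +-identityʳ (f b) ⟩
  f b ∎
  where open ≡-Reasoning
... | no b≮M with refl ← ≤-antisym (s≤s⁻¹ b<1+M) (≮⇒≥ b≮M) = begin
  sumBelow b (λ a → f a * δ a b) + f b * δ b b
    ≡⟨ cong₂ _+_ (sumBelow-≡0 b (λ a a<b → *-δ-≢ (f a) (<⇒≢ a<b))) (cong (f b *_) (δ-refl b)) ⟩
  0 + f b * 1
    ≡⟨ *-identityʳ (f b) ⟩
  f b ∎
  where open ≡-Reasoning

sumBelow-double : ∀ M (g : ℕ → ℕ) → sumBelow (2 * M) g ≡ sumBelow M (λ i → g (2 * i) + g (suc (2 * i)))
sumBelow-double zero    g = refl
sumBelow-double (suc M) g = begin
  sumBelow (2 * suc M) g
    ≡⟨ cong (λ t → sumBelow t g) (*-suc 2 M) ⟩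
  (sumBelow (2 * M) g + g (2 * M)) + g (suc (2 * M))
    ≡⟨ +-assoc (sumBelow (2 * M) g) _ _ ⟩
  sumBelow (2 * M) g + (g (2 * M) + g (suc (2 * M)))
    ≡⟨ cong (_+ (g (2 * M) + g (suc (2 * M)))) (sumBelow-double M g) ⟩
  sumBelow M (λ i → g (2 * i) + g (suc (2 * i))) + (g (2 * M) + g (suc (2 * M))) ∎
  where open ≡-Reasoning

∑-sumBelow-comm : ∀ M (h : ℕ → A → ℕ) (xs : List A) →
  ∑ (λ x → sumBelow M (λ i → h i x)) xs ≡ sumBelow M (λ i → ∑ (h i) xs)
∑-sumBelow-comm zero    h xs = ∑-≡0 xs (λ _ → refl)
∑-sumBelow-comm (suc M) h xs =
  trans (∑-+ (λ x → sumBelow M (λ i → h i x)) (h M) xs) (cong (_+ ∑ (h M) xs) (∑-sumBelow-comm M h xs))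

onMultiplesOf : ℕ → ℕ → ℕ
onMultiplesOf k a with k ∣? a
... | yes _ = a
... | no  _ = 0

onMultiplesOf-0 : ∀ k → onMultiplesOf k 0 ≡ 0
onMultiplesOf-0 k with k ∣? 0
... | yes _ = refl
... | no  _ = refl

onMultiplesOf-double : ∀ k a → onMultiplesOf (2 * k) (2 * a) ≡ 2 * onMultiplesOf k a
onMultiplesOf-double k a with 2 * k ∣? 2 * a | k ∣? a
... | yes _      | yes _    = refl
... | yes 2k∣2a  | no  k∤a  = ⊥-elim (k∤a (*-cancelˡ-∣ 2 2k∣2a))
... | no  2k∤2a  | yes k∣a  = ⊥-elim (2k∤2a (*-monoʳ-∣ 2 k∣a))
... | no  _      | no  _    = refl

2∤1+2* : ∀ a → ¬ (2 ∣ suc (2 * a))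
2∤1+2* a 2∣1+2a with () ← ∣1⇒≡1 (∣m+n∣m⇒∣n (subst (2 ∣_) (+-comm 1 (2 * a)) 2∣1+2a) (m∣m*n a))

onMultiplesOf-odd : ∀ k a → onMultiplesOf (2 * k) (suc (2 * a)) ≡ 0
onMultiplesOf-odd k a with 2 * k ∣? suc (2 * a)
... | yes 2k∣1+2a = ⊥-elim (2∤1+2* a (∣-trans (m∣m*n k) 2k∣1+2a))
... | no  _       = refl

novSum-∷-false : ∀ k b ps → novSum k ((b , false) ∷ ps) ≡ onMultiplesOf k b + novSum k ps
novSum-∷-false k b ps with k ∣? b
... | yes _ = refl
... | no  _ = refl

ovSum-∷-true : ∀ k b ps → ovSum k ((b , true) ∷ ps) ≡ onMultiplesOf k b + ovSum k ps
ovSum-∷-true k b ps with k ∣? b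
... | yes _ = refl
... | no  _ = refl

sumBelow-pick-+ : ∀ M (w c : ℕ → ℕ) {b} → b < M →
  w b + sumBelow M (λ a → w a * c a) ≡ sumBelow M (λ a → w a * (δ a b + c a))
sumBelow-pick-+ M w c {b} b<M = begin
  w b + sumBelow M (λ a → w a * c a)
    ≡⟨ cong (_+ sumBelow M (λ a → w a * c a)) (sumBelow-δ M w b<M) ⟨
  sumBelow M (λ a → w a * δ a b) + sumBelow M (λ a → w a * c a)
    ≡⟨ sumBelow-+ M (λ a → w a * δ a b) (λ a → w a * c a) ⟨
  sumBelow M (λ a → w a * δ a b + w a * c a)
    ≡⟨ sumBelow-cong M (λ a _ → *-distribˡ-+ (w a) (δ a b) (c a)) ⟨
  sumBelow M (λ a → w a * (δ a b + c a)) ∎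
  where open ≡-Reasoning

∑-sumBelow-*ˡ : ∀ M (f : A → ℕ) (w : ℕ → ℕ) (c : ℕ → A → ℕ) (xs : List A) →
  (∀ {x} → x ∈ xs → f x ≡ sumBelow M (λ a → w a * c a x)) →
  ∑ f xs ≡ sumBelow M (λ a → w a * ∑ (c a) xs)
∑-sumBelow-*ˡ M f w c xs f≡ = begin
  ∑ f xs                                     ≡⟨ ∑-cong xs f≡ ⟩
  ∑ (λ x → sumBelow M (λ a → w a * c a x)) xs ≡⟨ ∑-sumBelow-comm M (λ a x → w a * c a x) xs ⟩
  sumBelow M (λ a → ∑ (λ x → w a * c a x) xs) ≡⟨ sumBelow-cong M (λ a _ → ∑-*ˡ (w a) (c a) xs) ⟩
  sumBelow M (λ a → w a * ∑ (c a) xs)         ∎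
  where open ≡-Reasoning

novSum-by-size : ∀ k M ps → sizeSum ps < M →
  novSum k ps ≡ sumBelow M (λ a → onMultiplesOf k a * countNov a ps)
novSum-by-size k M [] _ = sym (sumBelow-≡0 M (λ a _ → *-zeroʳ (onMultiplesOf k a)))
novSum-by-size k M ((b , true) ∷ ps) s<M = novSum-by-size k M ps (≤-<-trans (m≤n+m _ b) s<M)
novSum-by-size k M ((b , false) ∷ ps) s<M =
  trans (novSum-∷-false k b ps)
        (trans (cong (onMultiplesOf k b +_) (novSum-by-size k M ps (≤-<-trans (m≤n+m _ b) s<M)))
               (sumBelow-pick-+ M (onMultiplesOf k) (λ a → countNov a ps) (≤-<-trans (m≤m+n b _) s<M)))

ovSum-by-size : ∀ k M ps → sizeSum ps < M →
  ovSum k ps ≡ sumBelow M (λ a → onMultiplesOf k a * countOv a ps)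
ovSum-by-size k M [] _ = sym (sumBelow-≡0 M (λ a _ → *-zeroʳ (onMultiplesOf k a)))
ovSum-by-size k M ((b , false) ∷ ps) s<M = ovSum-by-size k M ps (≤-<-trans (m≤n+m _ b) s<M)
ovSum-by-size k M ((b , true) ∷ ps) s<M =
  trans (ovSum-∷-true k b ps)
        (trans (cong (onMultiplesOf k b +_) (ovSum-by-size k M ps (≤-<-trans (m≤n+m _ b) s<M)))
               (sumBelow-pick-+ M (onMultiplesOf k) (λ a → countOv a ps) (≤-<-trans (m≤m+n b _) s<M)))

ovTotal-by-size : ∀ k M {n L} → n < M → Overpartitions n L →
  ovTotal k L ≡ sumBelow M (λ a → onMultiplesOf k a * ∑ (countOv a) L)
ovTotal-by-size k M {L = L} n<M (_ , L⇔) = ∑-sumBelow-*ˡ M (ovSum k) (onMultiplesOf k) countOv L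
  λ {x} x∈L → ovSum-by-size k M x (subst (_< M) (sym (sumsTo (to (L⇔ x) x∈L))) n<M)

novTotal-by-size : ∀ k M {n L} → n < M → Overpartitions n L →
  novTotal k L ≡ sumBelow M (λ a → onMultiplesOf k a * ∑ (countNov a) L)
novTotal-by-size k M {L = L} n<M (_ , L⇔) = ∑-sumBelow-*ˡ M (novSum k) (onMultiplesOf k) countNov L
  λ {x} x∈L → novSum-by-size k M x (subst (_< M) (sym (sumsTo (to (L⇔ x) x∈L))) n<M)

novTotal-double-by-size : ∀ k {n L} → Overpartitions n L →
  novTotal (2 * k) L ≡ sumBelow (suc n) (λ a → 2 * onMultiplesOf k a * ∑ (countNov (2 * a)) L)
novTotal-double-by-size k {n} {L} L-enum = begin
  novTotal (2 * k) L
    ≡⟨ novTotal-by-size (2 * k) (2 * suc n) (m≤m+n (suc n) _) L-enum ⟩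
  sumBelow (2 * suc n) g
    ≡⟨ sumBelow-double (suc n) g ⟩
  sumBelow (suc n) (λ a → g (2 * a) + g (suc (2 * a)))
    ≡⟨ sumBelow-cong (suc n) (λ a _ → cong₂ (λ u v → u * N (2 * a) + v * N (suc (2 * a)))
                                              (onMultiplesOf-double k a) (onMultiplesOf-odd k a)) ⟩
  sumBelow (suc n) (λ a → 2 * onMultiplesOf k a * N (2 * a) + 0)
    ≡⟨ sumBelow-cong (suc n) (λ a _ → +-identityʳ _) ⟩
  sumBelow (suc n) (λ a → 2 * onMultiplesOf k a * N (2 * a)) ∎
  where
  open ≡-Reasoning
  N : ℕ → ℕ
  N b = ∑ (countNov b) L
  g : ℕ → ℕ
  g b = onMultiplesOf (2 * k) b * N b

countIdentity-weighted : ∀ k a {n L} → Overpartitions n L →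
  onMultiplesOf k a * ∑ (countOv a) L + 2 * onMultiplesOf k a * ∑ (countNov (2 * a)) L
    ≡ onMultiplesOf k a * ∑ (countNov a) L
countIdentity-weighted k a {n} {L} L-enum = trans (factor (onMultiplesOf k a) _ _) (identity a)
  where
  factor : ∀ w o m → w * o + 2 * w * m ≡ w * (o + 2 * m)
  factor = solve-∀
  identity : ∀ a → onMultiplesOf k a * (∑ (countOv a) L + 2 * ∑ (countNov (2 * a)) L)
                     ≡ onMultiplesOf k a * ∑ (countNov a) L
  identity zero    rewrite onMultiplesOf-0 k = refl
  identity (suc a) = cong (onMultiplesOf k (suc a) *_) (countIdentity (s≤s z≤n) n L-enum)

-- The argument is uniform in k; for k = 0 both sides vanish.
mainTheorem3 : (k n : ℕ) → k ≥ 1 →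
    (L : List (List Part)) → Unique L →
    (∀ λ′ → (λ′ ∈ L) ⇔ IsOverpartition n λ′) →
    ovTotal k L + novTotal (2 * k) L ≡ novTotal k L
mainTheorem3 k n _ L L! L⇔ = begin
  ovTotal k L + novTotal (2 * k) L
    ≡⟨ cong₂ _+_ (ovTotal-by-size k (suc n) ≤-refl L-enum) (novTotal-double-by-size k L-enum) ⟩
  sumBelow (suc n) (λ a → w a * O a) + sumBelow (suc n) (λ a → 2 * w a * N (2 * a))
    ≡⟨ sumBelow-+ (suc n) (λ a → w a * O a) (λ a → 2 * w a * N (2 * a)) ⟨
  sumBelow (suc n) (λ a → w a * O a + 2 * w a * N (2 * a))
    ≡⟨ sumBelow-cong (suc n) (λ a _ → countIdentity-weighted k a L-enum) ⟩
  sumBelow (suc n) (λ a → w a * N a)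
    ≡⟨ novTotal-by-size k (suc n) ≤-refl L-enum ⟨
  novTotal k L ∎
  where
  open ≡-Reasoning
  L-enum : Overpartitions n L
  L-enum = L! , L⇔
  w O N : ℕ → ℕ
  w = onMultiplesOf k
  O a = ∑ (countOv a) L
  N a = ∑ (countNov a) L
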